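{- Let $d\in\mathbb{N}$ and $h_0>0$. Let $G$ be a reinforced gadget with $x\ge1$ subgadgets of size $y\ge 1$, built using a $d$-regular expander with expansion at least $h_0$. Then $G$ has expansion at least $c$, where $c>0$ is a constant depending only on $h_0$.
   Context: The expansion of a graph $G=(V,E)$ is $\min\{|E(S,\bar S)|/|S| : \emptyset\ne S\subseteq V, |S|\le |V|/2\}$, where $E(S,\bar S)$ is the set of edges between $S$ and $V\setminus S$. A reinforced gadget with $x$ subgadgets of size $y$ is obtained as follows: take $x$ vertex-disjoint paths (subgadgets), each on $y$ nodes; in each path, bipartition the nodes into the two color classes and call the larger class (either one if equal) the $X$-part and the other the $X'$-part; let $X$ be the union of the $X$-parts (so $|X|=x\lceil y/2\rceil$) and $X'$ the union of the $X'$-parts. Take a degree-$d$ expander graph on $x\lceil y/2\rceil$ nodes with expansion at least $h_0$, fix an arbitrary bijection between its nodes and $X$, and add its edges on $X$ accordingly.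
   Formalization: The expansion lower bound $h_0$ of the $d$-regular expander ranges over the positive rationals, and the constant $c$ is taken in the rationals. -}

module Defs where

open import Data.Nat using (ℕ; zero; suc; _+_; _*_; _≡ᵇ_; _%_; ⌈_/2⌉; _≤_)
open import Data.Bool using (Bool; true; false; _∧_; _∨_; not; _xor_; if_then_else_)
open import Data.Fin using (Fin; zero; suc; toℕ; remQuot)
open import Data.Product using (_×_; _,_; proj₁; proj₂)
open import Data.Integer using (+_)
open import Data.Rational using (ℚ; _/_) renaming (_*_ to _*ℚ_; _≤_ to _≤ℚ_)
open import Relation.Binary.PropositionalEquality using (_≡_)

ℕ→ℚ : ℕ → ℚ
ℕ→ℚ n = + n / 1

count : ∀ {n} → (Fin n → Bool) → ℕ
count {zero}  P = 0
count {suc n} P = (if P zero then 1 else 0) + count (λ i → P (suc i))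

record Graph (n : ℕ) : Set where
  field
    adj   : Fin n → Fin n → Bool
    sym   : ∀ u v → adj u v ≡ adj v u
    irrefl : ∀ u → adj u u ≡ false
open Graph public

sumFin : ∀ {n} → (Fin n → ℕ) → ℕ
sumFin {zero}  f = 0
sumFin {suc n} f = f zero + sumFin (λ i → f (suc i))

cutSize : ∀ {n} → (Fin n → Fin n → Bool) → (Fin n → Bool) → ℕ
cutSize A S = sumFin (λ u → count (λ v → S u ∧ not (S v) ∧ A u v))

HasExpansionAtLeast : ∀ {n} → (Fin n → Fin n → Bool) → ℚ → Set
HasExpansionAtLeast {n} A c =
  (S : Fin n → Bool) → 1 ≤ count S → 2 * count S ≤ n →
  c *ℚ ℕ→ℚ (count S) ≤ℚ ℕ→ℚ (cutSize A S)

IsRegular : ∀ {n} → Graph n → ℕ → Set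
IsRegular G d = ∀ u → count (adj G u) ≡ d

-- Reinforced gadget with x subgadgets (paths) of size y.
-- Vertices: Fin (x * y); vertex v corresponds to (i , j) = remQuot y v,
-- i.e. node j (0 ≤ j < y) of path i.  The X-part of path i is
-- the even positions (size ⌈y/2⌉) when flip i = false, and the odd positions
-- when flip i = true (allowed only when y is even, i.e. the classes are equal).

pathAdj : ∀ x y → Fin (x * y) → Fin (x * y) → Bool
pathAdj x y u v with remQuot {x} y u | remQuot {x} y v
... | (i , j) | (i' , j') =
  (toℕ i ≡ᵇ toℕ i') ∧ ((suc (toℕ j) ≡ᵇ toℕ j') ∨ (suc (toℕ j') ≡ᵇ toℕ j))

inX : ∀ x y → (flip : Fin x → Bool) → Fin (x * y) → Bool
inX x y flip v = (toℕ (proj₂ (remQuot {x} y v)) % 2 ≡ᵇ 0) xor flip (proj₁ (remQuot {x} y v))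

record BijectionOntoX {N m : ℕ} (X : Fin N → Bool) : Set where
  field
    to      : Fin m → Fin N
    from    : Fin N → Fin m
    to-in   : ∀ k → X (to k) ≡ true
    from-to : ∀ k → from (to k) ≡ k
    to-from : ∀ v → X v ≡ true → to (from v) ≡ v
open BijectionOntoX public

gadgetAdj : ∀ x y (flip : Fin x → Bool) {m} (H : Graph m) →
            BijectionOntoX {x * y} {m} (inX x y flip) →
            Fin (x * y) → Fin (x * y) → Bool
gadgetAdj x y flip H σ u v =
  pathAdj x y u v ∨
  (inX x y flip u ∧ inX x y flip v ∧ adj H (from σ u) (from σ v))

module Submission where

-- Let q be such that |S| ≤ q·|E(S, S̄)| for every set S of at most half of the expander's nodes
-- (the denominator of h₀ will do). Given a set S of at most half of the gadget's nodes, let T be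
-- whichever of S and S̄ contains at most half of X; as |S| ≤ |S̄| and both have the same cut, it
-- suffices to bound |T|. Every node of T ∩ X' has a path neighbour in X (this is where X is taken to
-- be the larger colour class), which lies either outside T, giving a cut edge, or in T ∩ X; and a
-- node of T ∩ X is a path neighbour of at most two nodes. Hence |T ∩ X'| ≤ |E(T, T̄)| + 2|T ∩ X|,
-- while |T ∩ X| ≤ q·|E(T, T̄)| because expander edges are gadget edges; so |T| ≤ (3q+1)·|E(T, T̄)|
-- and c = 1/(3q+1).

open import Defs hiding (sym)
open import Algebra.Bundles using (CommutativeMonoid)
open import Data.Bool using (Bool; true; false; not; _∧_; _∨_; _xor_; if_then_else_; T)
import Data.Bool.Properties as Boolₚ
open import Data.Empty using (⊥-elim)
open import Data.Fin using (Fin; zero; suc; toℕ; remQuot; combine; fromℕ<; inject₁)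
import Data.Fin.Properties as Finₚ
open import Data.Integer as ℤ using (+≤+)
import Data.Integer.Properties as ℤₚ
open import Data.Nat as ℕ using (ℕ; zero; suc; _+_; _*_; _≤_; _%_; _≡ᵇ_; _<ᵇ_; ⌈_/2⌉; z≤n)
import Data.Nat.Properties as ℕₚ
open import Data.Nat.Coprimality as Coprimality using (Coprime; 1-coprimeTo)
open import Data.Nat.Tactic.RingSolver using (solve-∀)
open import Data.Product using (Σ; _×_; _,_; proj₁; proj₂)
open import Data.Product.Function.NonDependent.Propositional using (_×-⇔_)
open import Data.Rational as ℚ using (ℚ; mkℚ; 0ℚ; _<_; *<*; toℚᵘ)
  renaming (_*_ to _*ℚ_; _≤_ to _≤ℚ_)
import Data.Rational.Properties as ℚₚ
open import Data.Rational.Unnormalised using (mkℚᵘ; *≤*)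
  renaming (_*_ to _*ᵘ_; _≤_ to _≤ᵘ_)
import Data.Rational.Unnormalised.Properties as ℚᵘₚ
open import Data.Sum as Sum using (_⊎_; inj₁; inj₂)
open import Data.Sum.Function.Propositional using (_⊎-⇔_)
open import Data.Vec.Functional using (updateAt)
open import Data.Vec.Functional.Properties using (updateAt-minimal)
open import Function using (_∘_; const; _⇔_; mk⇔; Equivalence)
import Function.Properties.Equivalence as ⇔
open import Relation.Binary.PropositionalEquality
  using (_≡_; refl; sym; trans; cong; cong₂; subst; subst₂; module ≡-Reasoning)
open import Relation.Nullary using (Dec; yes; no; contradiction)

open import Algebra.Properties.Semiring.Sum ℕₚ.+-*-semiring
  using (sum; sum-cong-≗; sum-replicate-zero; ∑-distrib-+; ∑-comm; *-distribˡ-sum)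
open import Algebra.Properties.CommutativeSemigroup ℕₚ.+-commutativeSemigroup
  using () renaming (x∙yz≈y∙xz to x+[y+z]≡y+[x+z])
open import Algebra.Properties.CommutativeSemigroup
  (CommutativeMonoid.commutativeSemigroup Boolₚ.∧-commutativeMonoid)
  using () renaming (x∙yz≈y∙xz to x∧[y∧z]≡y∧[x∧z])

-- Finite sums and counts

𝟙 : Bool → ℕ
𝟙 b = if b then 1 else 0

sumFin≡sum : ∀ {n} (f : Fin n → ℕ) → sumFin f ≡ sum f
sumFin≡sum {zero}  f = refl
sumFin≡sum {suc n} f = cong (f zero +_) (sumFin≡sum (f ∘ suc))

count≡sum𝟙 : ∀ {n} (P : Fin n → Bool) → count P ≡ sum (𝟙 ∘ P)
count≡sum𝟙 {zero}  P = refl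
count≡sum𝟙 {suc n} P = cong (𝟙 (P zero) +_) (count≡sum𝟙 (P ∘ suc))

sum-mono : ∀ {n} {f g : Fin n → ℕ} → (∀ i → f i ≤ g i) → sum f ≤ sum g
sum-mono {zero}  f≤g = z≤n
sum-mono {suc n} f≤g = ℕₚ.+-mono-≤ (f≤g zero) (sum-mono (f≤g ∘ suc))

sum≡at+sum-updateAt-0 : ∀ {n} (b : Fin n → ℕ) j → sum b ≡ b j + sum (updateAt b j (const 0))
sum≡at+sum-updateAt-0 b zero    = refl
sum≡at+sum-updateAt-0 b (suc j) = trans
  (cong (b zero +_) (sum≡at+sum-updateAt-0 (b ∘ suc) j))
  (x+[y+z]≡y+[x+z] (b zero) (b (suc j)) _)

sum-≤-injection : ∀ {n m} (f : Fin n → Fin m) {a : Fin n → ℕ} {b : Fin m → ℕ} →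
  (∀ u → a u ≤ b (f u)) →
  (∀ u u' → 1 ≤ a u → 1 ≤ a u' → f u ≡ f u' → u ≡ u') →
  sum a ≤ sum b
sum-≤-injection {zero}  f a≤b∘f inj = z≤n
sum-≤-injection {suc n} f {a} {b} a≤b∘f inj = split (1 ℕ.≤? a zero)
  where
  open ℕₚ.≤-Reasoning
  inj-suc : ∀ u u' → 1 ≤ a (suc u) → 1 ≤ a (suc u') → f (suc u) ≡ f (suc u') → u ≡ u'
  inj-suc u u' p p' e = Finₚ.suc-injective (inj (suc u) (suc u') p p' e)

  split : Dec (1 ≤ a zero) → sum a ≤ sum b
  split (no a₀≱1) = begin
    a zero + sum (a ∘ suc) ≡⟨ cong (_+ sum (a ∘ suc)) (ℕₚ.n<1⇒n≡0 (ℕₚ.≰⇒> a₀≱1)) ⟩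
    sum (a ∘ suc)          ≤⟨ sum-≤-injection (f ∘ suc) (a≤b∘f ∘ suc) inj-suc ⟩
    sum b                  ∎
  split (yes a₀≥1) = begin
    a zero + sum (a ∘ suc)                           ≤⟨ ℕₚ.+-mono-≤ (a≤b∘f zero) rest≤ ⟩
    b (f zero) + sum (updateAt b (f zero) (const 0)) ≡⟨ sum≡at+sum-updateAt-0 b (f zero) ⟨
    sum b                                            ∎
    where
    -- By injectivity no other point of the support of a is sent to f zero.
    a≤b' : ∀ u → a (suc u) ≤ updateAt b (f zero) (const 0) (f (suc u))
    a≤b' u with f (suc u) Finₚ.≟ f zero | 1 ℕ.≤? a (suc u)
    ... | no fu≢f₀  | _        = subst (a (suc u) ≤_) (sym (updateAt-minimal _ _ b fu≢f₀)) (a≤b∘f (suc u))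
    ... | yes fu≡f₀ | yes aᵤ≥1 = contradiction (inj (suc u) zero aᵤ≥1 a₀≥1 fu≡f₀) λ ()
    ... | yes _     | no aᵤ≱1  = subst (_≤ _) (sym (ℕₚ.n<1⇒n≡0 (ℕₚ.≰⇒> aᵤ≱1))) z≤n
    rest≤ : sum (a ∘ suc) ≤ sum (updateAt b (f zero) (const 0))
    rest≤ = sum-≤-injection (f ∘ suc) a≤b' inj-suc

_∩_ _∖_ : ∀ {n} → (Fin n → Bool) → (Fin n → Bool) → Fin n → Bool
(P ∩ Q) i = P i ∧ Q i
(P ∖ Q) i = P i ∧ not (Q i)

∁ : ∀ {n} → (Fin n → Bool) → Fin n → Bool
∁ P = not ∘ P

1≤count : ∀ {n} {P : Fin n → Bool} w → P w ≡ true → 1 ≤ count P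
1≤count {P = P} zero Pw rewrite Pw = ℕ.s≤s z≤n
1≤count {P = P} (suc w) Pw with P zero
... | true  = ℕ.s≤s z≤n
... | false = 1≤count {P = P ∘ suc} w Pw

∧≡true⇒ : ∀ {a b} → a ∧ b ≡ true → a ≡ true × b ≡ true
∧≡true⇒ {true} {true} _ = refl , refl

𝟙-mono : ∀ {b c} → (b ≡ true → c ≡ true) → 𝟙 b ≤ 𝟙 c
𝟙-mono {false} _   = z≤n
𝟙-mono {true}  b⇒c rewrite b⇒c refl = ℕₚ.≤-refl

1≤𝟙⇒≡true : ∀ {b} → 1 ≤ 𝟙 b → b ≡ true
1≤𝟙⇒≡true {true} _ = refl

count-≤-injection : ∀ {n m} (f : Fin n → Fin m) {P : Fin n → Bool} {Q : Fin m → Bool} →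
  (∀ u → P u ≡ true → Q (f u) ≡ true) →
  (∀ u u' → P u ≡ true → P u' ≡ true → f u ≡ f u' → u ≡ u') →
  count P ≤ count Q
count-≤-injection f {P} {Q} P⇒Q∘f inj = subst₂ _≤_ (sym (count≡sum𝟙 P)) (sym (count≡sum𝟙 Q))
  (sum-≤-injection f (λ u → 𝟙-mono (P⇒Q∘f u))
    (λ u u' p p' → inj u u' (1≤𝟙⇒≡true p) (1≤𝟙⇒≡true p')))

count≤1 : ∀ {n} {P : Fin n → Bool} → (∀ u u' → P u ≡ true → P u' ≡ true → u ≡ u') → count P ≤ 1
count≤1 unique = count-≤-injection {m = 1} (const zero) {Q = const true} (λ _ _ → refl)
  (λ u u' p p' _ → unique u u' p p')

count≡∩+∖ : ∀ {n} (P Q : Fin n → Bool) → count P ≡ count (P ∩ Q) + count (P ∖ Q)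
count≡∩+∖ {zero}  P Q = refl
count≡∩+∖ {suc n} P Q with P zero | Q zero
... | false | _     = count≡∩+∖ (P ∘ suc) (Q ∘ suc)
... | true  | true  = cong suc (count≡∩+∖ (P ∘ suc) (Q ∘ suc))
... | true  | false = trans (cong suc (count≡∩+∖ (P ∘ suc) (Q ∘ suc))) (sym (ℕₚ.+-suc _ _))

count+count-∁ : ∀ {n} (P : Fin n → Bool) → count P + count (∁ P) ≡ n
count+count-∁ {zero}  P = refl
count+count-∁ {suc n} P with P zero
... | true  = cong suc (count+count-∁ (P ∘ suc))
... | false = trans (ℕₚ.+-suc _ _) (cong suc (count+count-∁ (P ∘ suc)))

2*m≤m+n⇔m≤n : ∀ {m n} → 2 * m ≤ m + n ⇔ m ≤ n
2*m≤m+n⇔m≤n {m} {n} = mk⇔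
  (ℕₚ.+-cancelˡ-≤ m m n ∘ subst (_≤ m + n) 2*m≡m+m)
  (subst (_≤ m + n) (sym 2*m≡m+m) ∘ ℕₚ.+-monoʳ-≤ m)
  where 2*m≡m+m = cong (m +_) (ℕₚ.+-identityʳ m)

count≤count-∁ : ∀ {n} (P : Fin n → Bool) → 2 * count P ≤ n → count P ≤ count (∁ P)
count≤count-∁ P half =
  Equivalence.to 2*m≤m+n⇔m≤n (subst (2 * count P ≤_) (sym (count+count-∁ P)) half)

half-or-∁-half : ∀ {n} (P : Fin n → Bool) → 2 * count P ≤ n ⊎ 2 * count (∁ P) ≤ n
half-or-∁-half P with ℕₚ.≤-total (count P) (count (∁ P))
... | inj₁ p≤p' = inj₁ (subst (2 * count P ≤_) (count+count-∁ P) (Equivalence.from 2*m≤m+n⇔m≤n p≤p'))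
... | inj₂ p'≤p = inj₂ (subst (2 * count (∁ P) ≤_)
  (trans (ℕₚ.+-comm (count (∁ P)) (count P)) (count+count-∁ P)) (Equivalence.from 2*m≤m+n⇔m≤n p'≤p))

leaving : ∀ {n} → (Fin n → Fin n → Bool) → (Fin n → Bool) → Fin n → ℕ
leaving A S u = count (λ v → S u ∧ not (S v) ∧ A u v)

cutSize≡sum-leaving : ∀ {n} (A : Fin n → Fin n → Bool) S → cutSize A S ≡ sum (leaving A S)
cutSize≡sum-leaving A S = sumFin≡sum (leaving A S)

cutSize≡∑∑ : ∀ {n} (A : Fin n → Fin n → Bool) (S : Fin n → Bool) →
  cutSize A S ≡ sum (λ u → sum (λ v → 𝟙 (S u ∧ not (S v) ∧ A u v)))
cutSize≡∑∑ A S = trans (cutSize≡sum-leaving A S) (sum-cong-≗ (λ u → count≡sum𝟙 (λ v → S u ∧ not (S v) ∧ A u v)))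

cutSize-∁ : ∀ {n} (A : Fin n → Fin n → Bool) → (∀ u v → A u v ≡ A v u) →
  ∀ S → cutSize A (∁ S) ≡ cutSize A S
cutSize-∁ A A-sym S = begin
  cutSize A (∁ S)                                                   ≡⟨ cutSize≡∑∑ A (∁ S) ⟩
  sum (λ u → sum (λ v → 𝟙 (not (S u) ∧ not (not (S v)) ∧ A u v))) ≡⟨ ∑-comm (λ u v → 𝟙 (not (S u) ∧ not (not (S v)) ∧ A u v)) ⟩
  sum (λ v → sum (λ u → 𝟙 (not (S u) ∧ not (not (S v)) ∧ A u v))) ≡⟨ sum-cong-≗ (λ v → sum-cong-≗ (reversed v)) ⟩
  sum (λ v → sum (λ u → 𝟙 (S v ∧ not (S u) ∧ A v u)))               ≡⟨ cutSize≡∑∑ A S ⟨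
  cutSize A S                                                       ∎
  where
  open ≡-Reasoning
  reversed : ∀ v u → 𝟙 (not (S u) ∧ not (not (S v)) ∧ A u v) ≡ 𝟙 (S v ∧ not (S u) ∧ A v u)
  reversed v u rewrite A-sym u v with S u | S v
  ... | true  | true  = refl
  ... | true  | false = refl
  ... | false | true  = refl
  ... | false | false = refl

to-injective : ∀ {N m} {X : Fin N → Bool} (σ : BijectionOntoX {N} {m} X) {k l} →
  to σ k ≡ to σ l → k ≡ l
to-injective σ {k} {l} e = trans (sym (from-to σ k)) (trans (cong (from σ) e) (from-to σ l))

-- Expansion in ℕ

HasExpansionAtLeast1/ : ∀ {n} → (Fin n → Fin n → Bool) → ℕ → Set
HasExpansionAtLeast1/ {n} A q = (S : Fin n → Bool) → 2 * count S ≤ n → count S ≤ q * cutSize A S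

toℚᵘ-ℕ→ℚ : ∀ n → toℚᵘ (ℕ→ℚ n) ≡ mkℚᵘ (ℤ.+ n) 0
toℚᵘ-ℕ→ℚ n rewrite ℚₚ.normalize-coprime (Coprimality.sym (1-coprimeTo n)) = refl

mkℚᵘ*mkℚᵘ≤mkℚᵘ⇔ : ∀ n k a b →
  (mkℚᵘ (ℤ.+ n) k *ᵘ mkℚᵘ (ℤ.+ a) 0 ≤ᵘ mkℚᵘ (ℤ.+ b) 0) ⇔ (n * a ≤ b * suc k)
mkℚᵘ*mkℚᵘ≤mkℚᵘ⇔ n k a b = mk⇔
  (λ { (*≤* p) → ℤₚ.drop‿+≤+ (subst₂ ℤ._≤_ lhs rhs p) })
  (λ p → *≤* (subst₂ ℤ._≤_ (sym lhs) (sym rhs) (+≤+ p)))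
  where
  lhs : (ℤ.+ n ℤ.* ℤ.+ a) ℤ.* ℤ.+ 1 ≡ ℤ.+ (n * a)
  lhs = trans (ℤₚ.*-identityʳ _) (sym (ℤₚ.pos-* n a))
  rhs : ℤ.+ b ℤ.* ℤ.+ (suc k * 1) ≡ ℤ.+ (b * suc k)
  rhs = trans (sym (ℤₚ.pos-* b (suc k * 1))) (cong (λ d → ℤ.+ (b * d)) (ℕₚ.*-identityʳ (suc k)))

mkℚ*ℕ→ℚ≤ℕ→ℚ⇔ : ∀ n k .(c : Coprime n (suc k)) a b →
  (mkℚ (ℤ.+ n) k c *ℚ ℕ→ℚ a ≤ℚ ℕ→ℚ b) ⇔ (n * a ≤ b * suc k)
mkℚ*ℕ→ℚ≤ℕ→ℚ⇔ n k c a b = ⇔.trans (mk⇔ ℚₚ.toℚᵘ-mono-≤ ℚₚ.toℚᵘ-cancel-≤)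
  (⇔.trans (mk⇔ (ℚᵘₚ.≤-respʳ-≃ b≃ ∘ ℚᵘₚ.≤-respˡ-≃ pa≃)
                (ℚᵘₚ.≤-respʳ-≃ (ℚᵘₚ.≃-sym b≃) ∘ ℚᵘₚ.≤-respˡ-≃ (ℚᵘₚ.≃-sym pa≃)))
           (mkℚᵘ*mkℚᵘ≤mkℚᵘ⇔ n k a b))
  where
  p = mkℚ (ℤ.+ n) k c
  pa≃ = ℚᵘₚ.≃-trans (ℚₚ.toℚᵘ-homo-* p (ℕ→ℚ a))
                    (ℚᵘₚ.*-congˡ {toℚᵘ p} (ℚᵘₚ.≃-reflexive (toℚᵘ-ℕ→ℚ a)))
  b≃ = ℚᵘₚ.≃-reflexive (toℚᵘ-ℕ→ℚ b)

HasExpansionAtLeast⇒HasExpansionAtLeast1/ : ∀ h → 0ℚ < h →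
  Σ ℕ λ q → ∀ {n} (A : Fin n → Fin n → Bool) → HasExpansionAtLeast A h → HasExpansionAtLeast1/ A q
HasExpansionAtLeast⇒HasExpansionAtLeast1/ (mkℚ (ℤ.+ zero) k c) (*<* (ℤ.+<+ ()))
HasExpansionAtLeast⇒HasExpansionAtLeast1/ (mkℚ ℤ.-[1+ n ] k c) (*<* ())
HasExpansionAtLeast⇒HasExpansionAtLeast1/ (mkℚ (ℤ.+ suc n) k c) _ = suc k , bound
  where
  bound : ∀ {N} (A : Fin N → Fin N → Bool) → HasExpansionAtLeast A (mkℚ (ℤ.+ suc n) k c) →
          HasExpansionAtLeast1/ A (suc k)
  bound A expands S half with 1 ℕ.≤? count S
  ... | no  S≱1 = subst (_≤ suc k * cutSize A S) (sym (ℕₚ.n<1⇒n≡0 (ℕₚ.≰⇒> S≱1))) z≤n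
  ... | yes S≥1 = begin
    count S                    ≤⟨ ℕₚ.m≤n*m (count S) (suc n) ⟩
    suc n * count S            ≤⟨ Equivalence.to (mkℚ*ℕ→ℚ≤ℕ→ℚ⇔ (suc n) k c (count S) (cutSize A S)) (expands S S≥1 half) ⟩
    cutSize A S * suc k        ≡⟨ ℕₚ.*-comm (cutSize A S) (suc k) ⟩
    suc k * cutSize A S        ∎
    where open ℕₚ.≤-Reasoning

HasExpansionAtLeast1/⇒HasExpansionAtLeast : ∀ k {n} (A : Fin n → Fin n → Bool) →
  HasExpansionAtLeast1/ A (suc k) → HasExpansionAtLeast A (ℤ.+ 1 ℚ./ suc k)
HasExpansionAtLeast1/⇒HasExpansionAtLeast k A expands S _ half
  rewrite ℚₚ.normalize-coprime (1-coprimeTo (suc k)) =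
  Equivalence.from (mkℚ*ℕ→ℚ≤ℕ→ℚ⇔ 1 k _ (count S) (cutSize A S))
    (subst₂ _≤_ (sym (ℕₚ.*-identityˡ (count S))) (ℕₚ.*-comm (suc k) (cutSize A S)) (expands S half))

-- Reinforcing an expander

module Reinforcement
  {N m : ℕ} (A P : Fin N → Fin N → Bool) (X : Fin N → Bool)
  (H : Graph m) (σ : BijectionOntoX {N} {m} X) (Δ : ℕ)
  (A-sym : ∀ u v → A u v ≡ A v u)
  (P⊆A : ∀ {u v} → P u v ≡ true → A u v ≡ true)
  (H⊆A : ∀ {k l} → adj H k l ≡ true → A (to σ k) (to σ l) ≡ true)
  (P-indegree≤Δ : ∀ v → count (λ u → P u v) ≤ Δ)
  (P-leads-into-X : ∀ u → X u ≡ false → Σ (Fin N) λ w → P u w ≡ true × X w ≡ true)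
  where

  count-∖X≤ : ∀ T → count (T ∖ X) ≤ cutSize A T + Δ * count (T ∩ X)
  count-∖X≤ T = begin
    count (T ∖ X)                                                 ≡⟨ count≡sum𝟙 (T ∖ X) ⟩
    sum (λ u → 𝟙 (T u ∧ not (X u)))                               ≤⟨ sum-mono escapes ⟩
    sum (λ u → leaving A T u + count (λ v → (T ∩ X) v ∧ P u v))   ≡⟨ ∑-distrib-+ (leaving A T) _ ⟩
    sum (leaving A T) + sum (λ u → count (λ v → (T ∩ X) v ∧ P u v))
      ≡⟨ cong₂ _+_ (sym (cutSize≡sum-leaving A T)) (sum-cong-≗ (λ u → count≡sum𝟙 (λ v → (T ∩ X) v ∧ P u v))) ⟩
    cutSize A T + sum (λ u → sum (λ v → 𝟙 ((T ∩ X) v ∧ P u v)))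
      ≡⟨ cong (cutSize A T +_) (∑-comm (λ u v → 𝟙 ((T ∩ X) v ∧ P u v))) ⟩
    cutSize A T + sum (λ v → sum (λ u → 𝟙 ((T ∩ X) v ∧ P u v)))   ≤⟨ ℕₚ.+-monoʳ-≤ (cutSize A T) (sum-mono absorbs) ⟩
    cutSize A T + sum (λ v → Δ * 𝟙 ((T ∩ X) v))                   ≡⟨ cong (cutSize A T +_) (*-distribˡ-sum Δ (𝟙 ∘ (T ∩ X))) ⟨
    cutSize A T + Δ * sum (𝟙 ∘ (T ∩ X))                           ≡⟨ cong (λ c → cutSize A T + Δ * c) (count≡sum𝟙 (T ∩ X)) ⟨
    cutSize A T + Δ * count (T ∩ X)                               ∎
    where
    open ℕₚ.≤-Reasoning

    escapes : ∀ u → 𝟙 (T u ∧ not (X u)) ≤ leaving A T u + count (λ v → (T ∩ X) v ∧ P u v)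
    escapes u with T u | X u in Xu
    ... | false | _    = z≤n
    ... | true  | true = z≤n
    ... | true  | false with P-leads-into-X u Xu
    ...   | w , Puw , Xw with T w in Tw
    ...     | true  = ℕₚ.≤-trans (1≤count w into) (ℕₚ.m≤n+m _ _)
      where into : (T w ∧ X w) ∧ P u w ≡ true
            into rewrite Tw | Xw | Puw = refl
    ...     | false = ℕₚ.≤-trans (1≤count w out) (ℕₚ.m≤m+n _ _)
      where out : not (T w) ∧ A u w ≡ true
            out rewrite Tw | P⊆A Puw = refl

    absorbs : ∀ v → sum (λ u → 𝟙 ((T ∩ X) v ∧ P u v)) ≤ Δ * 𝟙 ((T ∩ X) v)
    absorbs v with (T ∩ X) v
    ... | true  = subst₂ _≤_ (count≡sum𝟙 (λ u → P u v)) (sym (ℕₚ.*-identityʳ Δ)) (P-indegree≤Δ v)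
    ... | false = ℕₚ.≤-reflexive (trans (sum-replicate-zero N) (sym (ℕₚ.*-zeroʳ Δ)))

  count-∩X≤count-pullback : ∀ T → count (T ∩ X) ≤ count (T ∘ to σ)
  count-∩X≤count-pullback T = count-≤-injection (from σ)
    (λ v TXv → let Tv , Xv = ∧≡true⇒ TXv in trans (cong T (to-from σ v Xv)) Tv)
    (λ v v' TXv TXv' e → trans (sym (to-from σ v (proj₂ (∧≡true⇒ TXv))))
                        (trans (cong (to σ) e) (to-from σ v' (proj₂ (∧≡true⇒ TXv')))))

  cutSize-pullback≤ : ∀ T → cutSize (adj H) (T ∘ to σ) ≤ cutSize A T
  cutSize-pullback≤ T = begin
    cutSize (adj H) (T ∘ to σ)       ≡⟨ cutSize≡sum-leaving (adj H) (T ∘ to σ) ⟩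
    sum (leaving (adj H) (T ∘ to σ)) ≤⟨ sum-mono leaving-pullback≤ ⟩
    sum (leaving A T ∘ to σ)         ≤⟨ sum-≤-injection (to σ) (λ _ → ℕₚ.≤-refl) (λ _ _ _ _ → to-injective σ) ⟩
    sum (leaving A T)                ≡⟨ cutSize≡sum-leaving A T ⟨
    cutSize A T                      ∎
    where
    open ℕₚ.≤-Reasoning
    leaving-pullback≤ : ∀ k → leaving (adj H) (T ∘ to σ) k ≤ leaving A T (to σ k)
    leaving-pullback≤ k = count-≤-injection (to σ)
      (λ l e → let Tk , rest = ∧≡true⇒ {T (to σ k)} e
                   T̸l , Hkl = ∧≡true⇒ {not (T (to σ l))} rest
               in cong₂ _∧_ Tk (cong₂ _∧_ T̸l (H⊆A {k} {l} Hkl)))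
      (λ _ _ _ _ → to-injective σ)

  module _ (q : ℕ) (H-expands : HasExpansionAtLeast1/ (adj H) q) where

    bound-if-X-part-small : ∀ T → 2 * count (T ∘ to σ) ≤ m → count T ≤ suc (suc Δ * q) * cutSize A T
    bound-if-X-part-small T small = begin
      count T                                      ≡⟨ count≡∩+∖ T X ⟩
      count (T ∩ X) + count (T ∖ X)                ≤⟨ ℕₚ.+-monoʳ-≤ (count (T ∩ X)) (count-∖X≤ T) ⟩
      count (T ∩ X) + (cut + Δ * count (T ∩ X))    ≤⟨ ℕₚ.+-mono-≤ T∩X≤ (ℕₚ.+-monoʳ-≤ cut (ℕₚ.*-monoʳ-≤ Δ T∩X≤)) ⟩
      q * cut + (cut + Δ * (q * cut))              ≡⟨ collect q cut Δ ⟩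
      suc (suc Δ * q) * cut                        ∎
      where
      open ℕₚ.≤-Reasoning
      cut = cutSize A T
      T∩X≤ : count (T ∩ X) ≤ q * cut
      T∩X≤ = begin
        count (T ∩ X)                        ≤⟨ count-∩X≤count-pullback T ⟩
        count (T ∘ to σ)                     ≤⟨ H-expands (T ∘ to σ) small ⟩
        q * cutSize (adj H) (T ∘ to σ)       ≤⟨ ℕₚ.*-monoʳ-≤ q (cutSize-pullback≤ T) ⟩
        q * cut                              ∎
      collect : ∀ q c Δ → q * c + (c + Δ * (q * c)) ≡ suc (suc Δ * q) * c
      collect = solve-∀

    expansion : HasExpansionAtLeast1/ A (suc (suc Δ * q))
    expansion S half with half-or-∁-half (S ∘ to σ)
    ... | inj₁ small = bound-if-X-part-small S small
    ... | inj₂ small = begin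
      count S                              ≤⟨ count≤count-∁ S half ⟩
      count (∁ S)                          ≤⟨ bound-if-X-part-small (∁ S) small ⟩
      suc (suc Δ * q) * cutSize A (∁ S)    ≡⟨ cong (suc (suc Δ * q) *_) (cutSize-∁ A A-sym S) ⟩
      suc (suc Δ * q) * cutSize A S        ∎
      where open ℕₚ.≤-Reasoning

-- Disjoint paths

Consecutive : ℕ → ℕ → Set
Consecutive i j = suc i ≡ j ⊎ suc j ≡ i

consecutive-above : ∀ {a c} → Consecutive a c → (c <ᵇ a) ≡ true → a ≡ suc c
consecutive-above {a} (inj₁ refl) c<a =
  contradiction (ℕₚ.<ᵇ⇒< _ a (Equivalence.from Boolₚ.T-≡ c<a)) (ℕₚ.<-asym (ℕₚ.n<1+n a))
consecutive-above     (inj₂ e)    _   = sym e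

consecutive-below : ∀ {a c} → Consecutive a c → (c <ᵇ a) ≡ false → suc a ≡ c
consecutive-below     (inj₁ e)    _   = e
consecutive-below {c = c} (inj₂ refl) c≮a = ⊥-elim (subst T c≮a (ℕₚ.<⇒<ᵇ (ℕₚ.n<1+n c)))

isEven : ℕ → Bool
isEven n = n % 2 ≡ᵇ 0

isEven-suc : ∀ n → isEven (suc n) ≡ not (isEven n)
isEven-suc zero          = refl
isEven-suc (suc zero)    = refl
isEven-suc (suc (suc n)) = isEven-suc n

isEven-consecutive : ∀ {a b} → Consecutive a b → isEven a ≡ not (isEven b)
isEven-consecutive {a} (inj₁ refl) = sym (trans (cong not (isEven-suc a)) (Boolₚ.not-involutive _))
isEven-consecutive {b = b} (inj₂ refl) = isEven-suc b

consecutive-in-Fin : ∀ {n} → 2 ≤ n → (i : Fin n) → Σ (Fin n) λ j → Consecutive (toℕ i) (toℕ j)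
consecutive-in-Fin 2≤n zero    = fromℕ< 2≤n , inj₁ (sym (Finₚ.toℕ-fromℕ< 2≤n))
consecutive-in-Fin _   (suc i) = inject₁ i , inj₂ (cong suc (Finₚ.toℕ-inject₁ i))

module Paths (x y : ℕ) where

  row : Fin (x * y) → Fin x
  row u = proj₁ (remQuot {x} y u)

  col : Fin (x * y) → Fin y
  col u = proj₂ (remQuot {x} y u)

  row-combine : ∀ (i : Fin x) (j : Fin y) → row (combine i j) ≡ i
  row-combine i j = cong proj₁ (Finₚ.remQuot-combine i j)

  col-combine : ∀ (i : Fin x) (j : Fin y) → col (combine i j) ≡ j
  col-combine i j = cong proj₂ (Finₚ.remQuot-combine i j)

  row-col-injective : ∀ {u v} → row u ≡ row v → col u ≡ col v → u ≡ v
  row-col-injective {u} {v} r c = begin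
    u                           ≡⟨ Finₚ.combine-remQuot {x} y u ⟨
    combine (row u) (col u)     ≡⟨ cong₂ combine r c ⟩
    combine (row v) (col v)     ≡⟨ Finₚ.combine-remQuot {x} y v ⟩
    v                           ∎
    where open ≡-Reasoning

  pathAdj⇔ : ∀ {u v} → pathAdj x y u v ≡ true ⇔ (row u ≡ row v × Consecutive (toℕ (col u)) (toℕ (col v)))
  pathAdj⇔ = ⇔.trans (⇔.sym Boolₚ.T-≡)
    (⇔.trans Boolₚ.T-∧ ((⇔.trans ≡ᵇ⇔ (mk⇔ Finₚ.toℕ-injective (cong toℕ)))
                        ×-⇔ ⇔.trans Boolₚ.T-∨ (≡ᵇ⇔ ⊎-⇔ ≡ᵇ⇔)))
    where
    ≡ᵇ⇔ : ∀ {m n} → T (m ≡ᵇ n) ⇔ m ≡ n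
    ≡ᵇ⇔ = mk⇔ (ℕₚ.≡ᵇ⇒≡ _ _) (ℕₚ.≡⇒≡ᵇ _ _)

  pathAdj-sym : ∀ u v → pathAdj x y u v ≡ pathAdj x y v u
  pathAdj-sym u v = Boolₚ.⇔→≡ (⇔.trans pathAdj⇔ (⇔.trans (mk⇔ swap swap) (⇔.sym pathAdj⇔)))
    where
    swap : ∀ {u v} → row u ≡ row v × Consecutive (toℕ (col u)) (toℕ (col v)) →
                     row v ≡ row u × Consecutive (toℕ (col v)) (toℕ (col u))
    swap (r , c) = sym r , Sum.swap c

  pathAdj-indegree≤2 : ∀ v → count (λ u → pathAdj x y u v) ≤ 2
  pathAdj-indegree≤2 v = begin
    count (λ u → pathAdj x y u v)             ≡⟨ count≡∩+∖ (λ u → pathAdj x y u v) above ⟩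
    count ((λ u → pathAdj x y u v) ∩ above)
      + count ((λ u → pathAdj x y u v) ∖ above) ≤⟨ ℕₚ.+-mono-≤ (count≤1 unique-above) (count≤1 unique-below) ⟩
    2                                           ∎
    where
    open ℕₚ.≤-Reasoning
    above : Fin (x * y) → Bool
    above u = toℕ (col v) <ᵇ toℕ (col u)

    same-column⇒≡ : ∀ {u u'} → pathAdj x y u v ≡ true → pathAdj x y u' v ≡ true →
                    toℕ (col u) ≡ toℕ (col u') → u ≡ u'
    same-column⇒≡ uv u'v c = row-col-injective
      (trans (proj₁ (Equivalence.to pathAdj⇔ uv)) (sym (proj₁ (Equivalence.to pathAdj⇔ u'v))))
      (Finₚ.toℕ-injective c)

    unique-above : ∀ u u' → pathAdj x y u v ∧ above u ≡ true → pathAdj x y u' v ∧ above u' ≡ true → u ≡ u'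
    unique-above u u' h h' with ∧≡true⇒ h | ∧≡true⇒ h'
    ... | uv , a | u'v , a' = same-column⇒≡ uv u'v (trans
      (consecutive-above (proj₂ (Equivalence.to pathAdj⇔ uv)) a)
      (sym (consecutive-above (proj₂ (Equivalence.to pathAdj⇔ u'v)) a')))

    unique-below : ∀ u u' → pathAdj x y u v ∧ not (above u) ≡ true →
                   pathAdj x y u' v ∧ not (above u') ≡ true → u ≡ u'
    unique-below u u' h h' with ∧≡true⇒ h | ∧≡true⇒ h'
    ... | uv , b | u'v , b' = same-column⇒≡ uv u'v (ℕₚ.suc-injective (trans
      (consecutive-below (proj₂ (Equivalence.to pathAdj⇔ uv)) (Boolₚ.not-injective b))
      (sym (consecutive-below (proj₂ (Equivalence.to pathAdj⇔ u'v)) (Boolₚ.not-injective b')))))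

  in-row-neighbour : ∀ u (j : Fin y) → Consecutive (toℕ (col u)) (toℕ j) →
                     pathAdj x y u (combine (row u) j) ≡ true
  in-row-neighbour u j c = Equivalence.from pathAdj⇔
    (sym (row-combine (row u) j) , subst (Consecutive _) (sym (cong toℕ (col-combine (row u) j))) c)

  has-path-neighbour : 2 ≤ y → ∀ u → Σ (Fin (x * y)) λ w → pathAdj x y u w ≡ true
  has-path-neighbour 2≤y u =
    let j , c = consecutive-in-Fin 2≤y (col u) in combine (row u) j , in-row-neighbour u j c

  inX-flips : ∀ {flip u v} → pathAdj x y u v ≡ true → inX x y flip u ≡ not (inX x y flip v)
  inX-flips {flip} {u} {v} uv with Equivalence.to pathAdj⇔ uv
  ... | r , c = begin
    isEven (toℕ (col u)) xor flip (row u)       ≡⟨ cong₂ _xor_ (isEven-consecutive c) (cong flip r) ⟩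
    not (isEven (toℕ (col v))) xor flip (row v) ≡⟨ Boolₚ.not-distribˡ-xor (isEven (toℕ (col v))) (flip (row v)) ⟨
    not (isEven (toℕ (col v)) xor flip (row v)) ∎
    where open ≡-Reasoning

inX-single-node-paths : ∀ x {flip : Fin x → Bool} → (∀ i → flip i ≡ true → 1 % 2 ≡ 0) →
                        ∀ u → inX x 1 flip u ≡ true
inX-single-node-paths x {flip} flip⇒even u = inX-at (Paths.row x 1 u) (Paths.col x 1 u)
  where
  inX-at : ∀ i (j : Fin 1) → isEven (toℕ j) xor flip i ≡ true
  inX-at i zero with flip i in fi
  ... | false = refl
  ... | true  = contradiction (flip⇒even i fi) λ ()

X'-leads-into-X : ∀ x y {flip : Fin x → Bool} → 1 ≤ y → (∀ i → flip i ≡ true → y % 2 ≡ 0) →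
  ∀ u → inX x y flip u ≡ false → Σ (Fin (x * y)) λ w → pathAdj x y u w ≡ true × inX x y flip w ≡ true
X'-leads-into-X x (suc zero) _ flip⇒even u u∉X =
  contradiction (trans (sym u∉X) (inX-single-node-paths x flip⇒even u)) λ ()
X'-leads-into-X x (suc (suc y)) {flip} _ _ u u∉X with Paths.has-path-neighbour x (suc (suc y)) (ℕ.s≤s (ℕ.s≤s z≤n)) u
... | w , uw = w , uw , Boolₚ.not-injective {y = true} (trans (sym (Paths.inX-flips x (suc (suc y)) {flip} uw)) u∉X)

-- The reinforced gadget

module _ (x y : ℕ) (flip : Fin x → Bool) {m} (H : Graph m)
         (σ : BijectionOntoX {x * y} {m} (inX x y flip)) where

  gadgetAdj-sym : ∀ u v → gadgetAdj x y flip H σ u v ≡ gadgetAdj x y flip H σ v u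
  gadgetAdj-sym u v = cong₂ _∨_ (Paths.pathAdj-sym x y u v) (begin
    X u ∧ X v ∧ adj H (from σ u) (from σ v)   ≡⟨ cong (λ b → X u ∧ X v ∧ b) (Graph.sym H _ _) ⟩
    X u ∧ X v ∧ adj H (from σ v) (from σ u)   ≡⟨ x∧[y∧z]≡y∧[x∧z] (X u) (X v) _ ⟩
    X v ∧ X u ∧ adj H (from σ v) (from σ u)   ∎)
    where
    open ≡-Reasoning
    X = inX x y flip

  pathAdj⊆gadgetAdj : ∀ {u v} → pathAdj x y u v ≡ true → gadgetAdj x y flip H σ u v ≡ true
  pathAdj⊆gadgetAdj {u} {v} uv =
    cong (_∨ (inX x y flip u ∧ inX x y flip v ∧ adj H (from σ u) (from σ v))) uv

  adj⊆gadgetAdj : ∀ {k l} → adj H k l ≡ true → gadgetAdj x y flip H σ (to σ k) (to σ l) ≡ true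
  adj⊆gadgetAdj {k} {l} kl rewrite to-in σ k | to-in σ l | from-to σ k | from-to σ l | kl =
    Boolₚ.∨-zeroʳ (pathAdj x y (to σ k) (to σ l))

reinforcedGadget-expansion : ∀ x y {flip : Fin x → Bool} → 1 ≤ y → (∀ i → flip i ≡ true → y % 2 ≡ 0) →
  ∀ {m} (H : Graph m) (σ : BijectionOntoX {x * y} {m} (inX x y flip)) →
  ∀ q → HasExpansionAtLeast1/ (adj H) q → HasExpansionAtLeast1/ (gadgetAdj x y flip H σ) (suc (3 * q))
reinforcedGadget-expansion x y {flip} 1≤y flip⇒even H σ =
  Reinforcement.expansion (gadgetAdj x y flip H σ) (pathAdj x y) (inX x y flip) H σ 2
    (gadgetAdj-sym x y flip H σ) (pathAdj⊆gadgetAdj x y flip H σ) (adj⊆gadgetAdj x y flip H σ)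
    (Paths.pathAdj-indegree≤2 x y) (X'-leads-into-X x y 1≤y flip⇒even)

lemma26 : (h₀ : ℚ) → 0ℚ < h₀ →
    Σ ℚ (λ c → 0ℚ < c ×
    ((d x y : ℕ) → 1 ≤ x → 1 ≤ y →
    (flip : Fin x → Bool) → (∀ i → flip i ≡ true → y % 2 ≡ 0) →
    (H : Graph (x * ⌈ y /2⌉)) → IsRegular H d →
    HasExpansionAtLeast (adj H) h₀ →
    (σ : BijectionOntoX {x * y} {x * ⌈ y /2⌉} (inX x y flip)) →
    HasExpansionAtLeast (gadgetAdj x y flip H σ) c))
lemma26 h₀ h₀>0 =
  let q , H-bound = HasExpansionAtLeast⇒HasExpansionAtLeast1/ h₀ h₀>0 in
  ℤ.+ 1 ℚ./ suc (3 * q) , ℚₚ.positive⁻¹ _ {{ℚₚ.normalize-pos 1 (suc (3 * q))}} ,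
  λ d x y _ 1≤y flip flip⇒even H _ H-expands σ →
    HasExpansionAtLeast1/⇒HasExpansionAtLeast (3 * q) (gadgetAdj x y flip H σ)
      (reinforcedGadget-expansion x y 1≤y flip⇒even H σ q (H-bound (adj H) H-expands))
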